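{- There exists a defeasible logic containing an inference rule that is applicability persistent but not stable.
   Context: Literals are propositions $p$ or their negations $\neg p$; ${\sim}q$ denotes the complementary literal. A defeasible theory is a triple $D=(F,R,>)$ where $F$ is a finite set of literals (facts), $R$ is a finite set of labelled rules, each rule $r$ having a finite set $A(r)$ of literals (antecedent), a type (strict $\rightarrow$, defeasible $\Rightarrow$, or defeater $\leadsto$) and a literal $C(r)$ (consequent), and $>$ is an acyclic binary relation on $R$. A conclusion has the form $+d\,q$ or $-d\,q$, where $d$ is a tag and $q$ a literal. An inference rule has the form "We may append $\pm d\,q$ to $P$ if $C$", where $\pm d$ is the tag of the rule and the applicability condition $C=C(D,q,P)$ is a Boolean-valued condition depending on the theory $D$, the literal $q$ and the sequence of conclusions $P$ built so far. A defeasible logic consists of a language of defeasible theories and a finite set of inference rules (no two with the same tag); a proof from $D$ is a finite sequence of conclusions each of which can be appended, by some inference rule of the logic, to the sequence of conclusions preceding it. An inference rule with applicability condition $C$ is stable if for every proof $P$ and every proof $Q$ that contains $P$ as a subsequence (not necessarily contiguous), $C(P)\rightarrow C(Q)$ holds (for all $D$ and $q$). It is applicability persistent if for every proof $P$ and every proof $Q$ having $P$ as a prefix, $C(P)\rightarrow C(Q)$. -}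

module Defs where

open import Data.Nat using (ℕ)
open import Data.Bool using (Bool; true; false)
open import Data.Product using (_×_; _,_; ∃; Σ)
open import Data.List using (List; []; _∷_; _++_; [_]; map)
open import Data.List.Membership.Propositional using (_∈_)
open import Data.List.Relation.Unary.Unique.Propositional using (Unique)
open import Data.List.Relation.Binary.Sublist.Propositional using (_⊆_)
open import Relation.Binary.Construct.Closure.Transitive using (TransClosure)
open import Relation.Binary.PropositionalEquality using (_≡_)
open import Relation.Nullary using (¬_)

Prop : Set
Prop = ℕ

data Literal : Set where
  pos : Prop → Literal
  neg : Prop → Literal

∼_ : Literal → Literal
∼ pos p = neg p
∼ neg p = pos p

data RuleType : Set where
  strict defeasible defeater : RuleType

record Rule : Set where
  constructor mkRule
  field
    label      : ℕ
    antecedent : List Literal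
    type       : RuleType
    consequent : Literal

-- A defeasible theory D = (F, R, >).  F and R are finite sets (lists); > is a finite
-- binary relation on R given by a list of pairs (r , s) meaning r > s.
record Theory : Set where
  constructor mkTheory
  field
    facts : List Literal
    rules : List Rule
    sup   : List (Rule × Rule)

_⊳[_]_ : Rule → Theory → Rule → Set
r ⊳[ D ] s = (r , s) ∈ Theory.sup D

WellFormed : Theory → Set
WellFormed D =
  (∀ r s → r ⊳[ D ] s → (r ∈ Theory.rules D) × (s ∈ Theory.rules D)) ×
  (∀ r → ¬ TransClosure (λ x y → x ⊳[ D ] y) r r)

-- Tags d are indexed by ℕ; a signed tag ±d is a sign (true = +, false = −) with a tag.
Tag : Set
Tag = ℕ

SignedTag : Set
SignedTag = Bool × Tag

record Conclusion : Set where
  constructor conc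
  field
    sign : Bool
    tag  : Tag
    lit  : Literal

signedTag : Conclusion → SignedTag
signedTag c = Conclusion.sign c , Conclusion.tag c

record InferenceRule : Set where
  constructor mkInf
  field
    itag : SignedTag
    cond : Theory → Literal → List Conclusion → Bool

record DefeasibleLogic : Set₁ where
  field
    language  : Theory → Set
    langWF    : ∀ D → language D → WellFormed D
    infRules  : List InferenceRule
    tagsDistinct : Unique (map InferenceRule.itag infRules)

data IsProof (L : DefeasibleLogic) (D : Theory) : List Conclusion → Set where
  empty  : IsProof L D []
  append : ∀ {P} (c : Conclusion) (ir : InferenceRule) →
           IsProof L D P →
           ir ∈ DefeasibleLogic.infRules L →
           InferenceRule.itag ir ≡ signedTag c →
           InferenceRule.cond ir D (Conclusion.lit c) P ≡ true →
           IsProof L D (P ++ [ c ])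

_IsPrefixOf_ : List Conclusion → List Conclusion → Set
P IsPrefixOf Q = ∃ λ S → Q ≡ P ++ S

Stable : DefeasibleLogic → InferenceRule → Set
Stable L ir = ∀ D → DefeasibleLogic.language L D → ∀ q P Q →
  IsProof L D P → IsProof L D Q → P ⊆ Q →
  InferenceRule.cond ir D q P ≡ true → InferenceRule.cond ir D q Q ≡ true

ApplicabilityPersistent : DefeasibleLogic → InferenceRule → Set
ApplicabilityPersistent L ir = ∀ D → DefeasibleLogic.language L D → ∀ q P Q →
  IsProof L D P → IsProof L D Q → P IsPrefixOf Q →
  InferenceRule.cond ir D q P ≡ true → InferenceRule.cond ir D q Q ≡ true

-- A condition that inspects the first conclusion of the proof is applicability
-- persistent, because extending a proof at the end never changes its first
-- conclusion.  It is not stable: a proof Q containing P as a subsequence may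
-- start with a different conclusion, here −∂₁ q put in front of +∂₁ q.
module Submission where

open import Defs
open import Data.Bool using (Bool; true; false)
open import Data.Product using (Σ; ∃; _×_; _,_)
open import Data.List using (List; []; _∷_; _++_)
open import Data.List.Membership.Propositional using (_∈_)
open import Data.List.Relation.Unary.Any using (here; there)
open import Data.List.Relation.Unary.All using ([]; _∷_)
open import Data.List.Relation.Unary.AllPairs using ([]; _∷_)
open import Data.List.Relation.Binary.Sublist.Heterogeneous using ([]; _∷_; _∷ʳ_)
open import Relation.Binary.Construct.Closure.Transitive using (TransClosure; [_]; _∷_)
open import Relation.Binary.PropositionalEquality using (_≡_; refl)
open import Relation.Nullary using (¬_)

startsPositive : List Conclusion → Bool
startsPositive []      = false
startsPositive (c ∷ _) = Conclusion.sign c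

startsPositive-++ : ∀ P S → startsPositive P ≡ true → startsPositive (P ++ S) ≡ true
startsPositive-++ (c ∷ P) S eq = eq

firstIsPositive : SignedTag → InferenceRule
firstIsPositive t = mkInf t (λ _ _ → startsPositive)

firstIsPositive-persistent : ∀ L t → ApplicabilityPersistent L (firstIsPositive t)
firstIsPositive-persistent L t D _ q P Q _ _ (S , refl) = startsPositive-++ P S

unconditional : SignedTag → InferenceRule
unconditional t = mkInf t (λ _ _ _ → true)

+∂₀-first +∂₁ -∂₁ : InferenceRule
+∂₀-first = firstIsPositive (true , 0)
+∂₁       = unconditional (true , 1)
-∂₁       = unconditional (false , 1)

exampleLogic : DefeasibleLogic
exampleLogic = record
  { language     = WellFormed
  ; langWF       = λ _ wf → wf
  ; infRules     = +∂₀-first ∷ +∂₁ ∷ -∂₁ ∷ []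
  ; tagsDistinct = ((λ ()) ∷ (λ ()) ∷ []) ∷ ((λ ()) ∷ []) ∷ [] ∷ []
  }

emptyTheory : Theory
emptyTheory = mkTheory [] [] []

emptyTheory-wellFormed : WellFormed emptyTheory
emptyTheory-wellFormed = (λ _ _ ()) , λ _ → noCycle
  where
  noCycle : ∀ {r} → ¬ TransClosure (λ x y → x ⊳[ emptyTheory ] y) r r
  noCycle [ () ]
  noCycle (() ∷ _)

q : Literal
q = pos 0

+q -q : Conclusion
+q = conc true  1 q
-q = conc false 1 q

+q-proof : IsProof exampleLogic emptyTheory (+q ∷ [])
+q-proof = append +q +∂₁ empty (there (here refl)) refl refl

-q+q-proof : IsProof exampleLogic emptyTheory (-q ∷ +q ∷ [])
-q+q-proof = append +q +∂₁ -q-proof (there (here refl)) refl refl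
  where
  -q-proof : IsProof exampleLogic emptyTheory (-q ∷ [])
  -q-proof = append -q -∂₁ empty (there (there (here refl))) refl refl

+∂₀-first-unstable : ¬ Stable exampleLogic +∂₀-first
+∂₀-first-unstable stable
  with stable emptyTheory emptyTheory-wellFormed q (+q ∷ []) (-q ∷ +q ∷ [])
              +q-proof -q+q-proof (-q ∷ʳ (refl ∷ [])) refl
... | ()

proposition1 : Σ DefeasibleLogic λ L → ∃ λ ir → (ir ∈ DefeasibleLogic.infRules L) × ApplicabilityPersistent L ir × ¬ Stable L ir
proposition1 =
  exampleLogic , +∂₀-first , here refl ,
  firstIsPositive-persistent exampleLogic (true , 0) , +∂₀-first-unstable
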